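{- Let $U$ be a based scheme on $Y$ and $S$ a based scheme on $Z$, let $\tilde T\subseteq S$ be a closed subset, and let $i:U\to S$ be a based morphism of schemes such that $i\pi:U\to S/\!\!/\tilde T$ is an isomorphism ($\pi$ the natural morphism). Assume $|t(ui)|=1$ for every $u\in U$ and $t\in\tilde T$. For $u\in U$ put $\tilde T'_u=\{t\in\tilde T:t(ui)=\{ui\}\}$ and $\tilde T''_u=\{t\in\tilde T:(ui)t=\{ui\}\}$. Then $\tilde T'_u$ and $\tilde T''_u$ are closed subsets of $\tilde T$ (that is, $P^*P\subseteq P$ for $P\in\{\tilde T'_u,\tilde T''_u\}$).
   Context: All schemes are association schemes on finite sets. Complex product $pq=\{r\in S:a_{pqr}>0\}$, extended to subsets by unions; closed: $\tilde T^*\tilde T\subseteq\tilde T$. For closed $\tilde T$: $z\tilde T=\bigcup_{t\in\tilde T}zt$, $s^{\tilde T}=\{(z_1\tilde T,z_2\tilde T):(z_1',z_2')\in s$ for some $z_i'\in z_i\tilde T\}$, $S/\!\!/\tilde T=\{s^{\tilde T}\}$. A morphism $i$ from $U$ on $Y$ to $S$ on $Z$ is a map $Y\to Z$ sending pairs in a common element of $U$ to pairs in a common element of $S$; $ui$ is the element of $S$ containing the images of pairs of $u$. Isomorphisms are bijective on points and relations; based morphisms preserve basepoints. -}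

module Defs where

open import Data.Nat using (ℕ; zero; suc; _+_; _<_)
open import Data.Fin using (Fin; _≟_)
open import Data.List using (List; map)
open import Data.Nat.ListAction using (sum)
open import Data.List using () renaming (allFin to allFinL)
open import Data.Bool using (Bool; true; false; if_then_else_; _∧_)
open import Data.Product using (Σ; ∃; ∃-syntax; _×_; _,_)
open import Relation.Nullary.Decidable using (⌊_⌋)
open import Relation.Binary.PropositionalEquality using (_≡_)
open import Function.Bundles using (_⇔_)

countPath : {n m : ℕ} → (Fin n → Fin n → Fin m) → Fin m → Fin m → Fin n → Fin n → ℕ
countPath {n} rel p q x z =
  sum (map (λ y → if ⌊ rel x y ≟ p ⌋ ∧ ⌊ rel y z ≟ q ⌋ then 1 else 0) (allFinL n))

-- An association scheme on the point set Fin n with relation set S = Fin m;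
-- rel x y is the (unique) element of S containing (x , y).
record Scheme : Set where
  field
    n        : ℕ
    m        : ℕ
    rel      : Fin n → Fin n → Fin m
    nonempty : ∀ s → ∃[ x ] ∃[ y ] rel x y ≡ s
    one      : Fin m
    one-diag : ∀ x y → (rel x y ≡ one) ⇔ (x ≡ y)
    star     : Fin m → Fin m
    star-rel : ∀ x y → rel y x ≡ star (rel x y)
    regular  : ∀ p q x z x' z' → rel x z ≡ rel x' z' →
               countPath rel p q x z ≡ countPath rel p q x' z'

record BasedScheme : Set₁ where
  field
    scheme : Scheme
  open Scheme scheme public
  field
    base : Fin n

module _ (S : Scheme) where
  open Scheme S

  _∈[_·_] : Fin m → Fin m → Fin m → Set
  r ∈[ p · q ] = ∃[ x ] ∃[ z ] (rel x z ≡ r × 0 < countPath rel p q x z)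

  Closed : (Fin m → Set) → Set
  Closed T = ∀ p q r → T p → T q → r ∈[ star p · q ] → T r

  ProdIsSingleton : Fin m → Fin m → Fin m → Set
  ProdIsSingleton p q s = ∀ r → (r ∈[ p · q ]) ⇔ (r ≡ s)

  ProdCard1 : Fin m → Fin m → Set
  ProdCard1 p q = ∃[ s ] ProdIsSingleton p q s

  module Quot (T : Fin m → Set) where
    -- z ∈ x T   (x T = ⋃_{t ∈ T} x t)
    InCoset : Fin n → Fin n → Set
    InCoset x z = T (rel x z)

    CosetEq : Fin n → Fin n → Set
    CosetEq x y = ∀ z → InCoset x z ⇔ InCoset y z

    InRelT : Fin m → Fin n → Fin n → Set
    InRelT s x y = ∃[ x' ] ∃[ y' ] (InCoset x x' × InCoset y y' × rel x' y' ≡ s)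

    RelTEq : Fin m → Fin m → Set
    RelTEq s s' = ∀ x y → InRelT s x y ⇔ InRelT s' x y

-- A morphism of schemes: a map on points together with the induced map on
-- relations u ↦ u i (well defined since every relation is nonempty).
record Morphism (U S : Scheme) : Set where
  private
    module U = Scheme U
    module S = Scheme S
  field
    pt      : Fin U.n → Fin S.n
    rl      : Fin U.m → Fin S.m
    pt-rel  : ∀ y y' → S.rel (pt y) (pt y') ≡ rl (U.rel y y')

record BasedMorphism (U S : BasedScheme) : Set where
  private
    module U = BasedScheme U
    module S = BasedScheme S
  field
    mor  : Morphism U.scheme S.scheme
  open Morphism mor public
  field
    base-pres : pt U.base ≡ S.base

module _ {U S : Scheme} (i : Morphism U S) (T : Fin (Scheme.m S) → Set) where
  private
    module U = Scheme U
    open Quot S T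
  open Morphism i

  IsIsoToQuotient : Set
  IsIsoToQuotient =
    (∀ y y' → CosetEq (pt y) (pt y') → y ≡ y') ×
    (∀ z → ∃[ y ] CosetEq (pt y) z) ×
    (∀ u u' → RelTEq (rl u) (rl u') → u ≡ u') ×
    (∀ s → ∃[ u ] RelTEq (rl u) s)

-- Write r ∈ pq as a triangle x →p y →q z with x →r z; by regularity such a
-- triangle can be erected over every pair in r. If p, q ∈ T'_s and r ∈ p* q,
-- erect over a pair (x , y) ∈ r the triangle x →p* w →q y, then over (w , y) ∈ q
-- a triangle w →s v ←s y (possible since q ∈ s s*, as s ∈ q s). Now (x , v) lies
-- in p* s = {s}, so x →r y →s v exhibits s ∈ r s, and |r s| = 1 gives r s = {s}.
-- The statement for T''_s is the mirror image, using |r* s*| = 1 to conclude.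
module Submission where

open import Defs
open import Data.Bool using (_∧_; if_then_else_)
open import Data.Fin using (Fin; _≟_)
open import Data.List using (List; _∷_; map) renaming (allFin to allFinL)
open import Data.List.Membership.Propositional using (_∈_)
open import Data.List.Membership.Propositional.Properties using (∈-allFin)
open import Data.List.Relation.Unary.Any using (Any; here; there; satisfied)
  renaming (map to Any-map)
open import Data.Nat using (ℕ; zero; suc; _<_; s≤s; z≤n)
open import Data.Nat.ListAction using (sum)
open import Data.Nat.Properties using (≤-trans; m≤m+n; m≤n+m)
open import Data.Product using (_×_; _,_; proj₂; ∃-syntax)
open import Function using (_∘_)
open import Function.Bundles using (_⇔_; mk⇔; Equivalence)
open import Relation.Nullary using (yes; no; contradiction)
open import Relation.Nullary.Decidable using (⌊_⌋)
open import Relation.Binary.PropositionalEquality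
  using (_≡_; refl; sym; trans; cong; subst; module ≡-Reasoning)

open Equivalence using (to; from)

sum-map-positive⁺ : ∀ {A : Set} (f : A → ℕ) {xs : List A} {x : A} →
                    x ∈ xs → 0 < f x → 0 < sum (map f xs)
sum-map-positive⁺ f {y ∷ _} (here refl) fx>0 = ≤-trans fx>0 (m≤m+n (f y) _)
sum-map-positive⁺ f {y ∷ _} (there x∈xs) fx>0 =
  ≤-trans (sum-map-positive⁺ f x∈xs fx>0) (m≤n+m _ (f y))

sum-map-positive⁻ : ∀ {A : Set} (f : A → ℕ) (xs : List A) →
                    0 < sum (map f xs) → Any (λ x → 0 < f x) xs
sum-map-positive⁻ f (x ∷ xs) sum>0 with f x in fx≡
... | zero  = there (sum-map-positive⁻ f xs sum>0)
... | suc _ = here (subst (0 <_) (sym fx≡) (s≤s z≤n))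

indicator-positive⇔ : ∀ {m} (a b p q : Fin m) →
                      0 < (if ⌊ a ≟ p ⌋ ∧ ⌊ b ≟ q ⌋ then 1 else 0) ⇔ (a ≡ p × b ≡ q)
indicator-positive⇔ a b p q with a ≟ p | b ≟ q
... | yes a≡p | yes b≡q = mk⇔ (λ _ → a≡p , b≡q) (λ _ → s≤s z≤n)
... | yes _   | no b≢q  = mk⇔ (λ ()) (λ (_ , b≡q) → contradiction b≡q b≢q)
... | no a≢p  | _       = mk⇔ (λ ()) (λ (a≡p , _) → contradiction a≡p a≢p)

countPath-positive⇔ : ∀ {n m} (rel : Fin n → Fin n → Fin m) p q x z →
                      0 < countPath rel p q x z ⇔ (∃[ y ] (rel x y ≡ p × rel y z ≡ q))
countPath-positive⇔ {n} rel p q x z = mk⇔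
  (λ count>0 → satisfied (Any-map (λ {y} → to (indicator-positive⇔ (rel x y) (rel y z) p q))
                                  (sum-map-positive⁻ _ (allFinL n) count>0)))
  (λ (y , path) → sum-map-positive⁺ _ (∈-allFin y)
                    (from (indicator-positive⇔ (rel x y) (rel y z) p q) path))

module Triangles (S : Scheme) where
  open Scheme S

  Triangle : Fin m → Fin m → Fin m → Set
  Triangle a b c = ∃[ x ] ∃[ y ] ∃[ z ] (rel x y ≡ a × rel y z ≡ b × rel x z ≡ c)

  ∈·⇔Triangle : ∀ {p q r} → _∈[_·_] S r p q ⇔ Triangle p q r
  ∈·⇔Triangle {p} {q} = mk⇔
    (λ (x , z , xz≡r , count>0) →
       let (y , xy≡p , yz≡q) = to (countPath-positive⇔ rel p q x z) count>0
       in x , y , z , xy≡p , yz≡q , xz≡r)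
    (λ (x , y , z , xy≡p , yz≡q , xz≡r) →
       x , z , xz≡r , from (countPath-positive⇔ rel p q x z) (y , xy≡p , yz≡q))

  Triangle-complete : ∀ {a b c} → Triangle a b c →
                      ∀ x z → rel x z ≡ c → ∃[ y ] (rel x y ≡ a × rel y z ≡ b)
  Triangle-complete {a} {b} (x₀ , y₀ , z₀ , xy≡a , yz≡b , xz≡c) x z x'z'≡c =
    to (countPath-positive⇔ rel a b x z)
       (subst (0 <_) (regular a b x₀ z₀ x z (trans xz≡c (sym x'z'≡c)))
              (from (countPath-positive⇔ rel a b x₀ z₀) (y₀ , xy≡a , yz≡b)))

  rel-flip : ∀ {x y a} → rel x y ≡ a → rel y x ≡ star a
  rel-flip {x} {y} xy≡a = trans (star-rel x y) (cong star xy≡a)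

  star-involutive : ∀ a → star (star a) ≡ a
  star-involutive a with nonempty a
  ... | x , y , xy≡a = trans (cong star (sym (rel-flip xy≡a))) (trans (sym (star-rel y x)) xy≡a)

  star-injective : ∀ {a b} → star a ≡ star b → a ≡ b
  star-injective {a} {b} a*≡b* =
    trans (sym (star-involutive a)) (trans (cong star a*≡b*) (star-involutive b))

  rel-flip-star : ∀ {x y a} → rel x y ≡ star a → rel y x ≡ a
  rel-flip-star {a = a} xy≡a* = trans (rel-flip xy≡a*) (star-involutive a)

  Triangle-rotateˡ : ∀ {a b c} → Triangle a b c → Triangle (star a) c b
  Triangle-rotateˡ (x , y , z , xy , yz , xz) = y , x , z , rel-flip xy , xz , yz

  Triangle-rotateʳ : ∀ {a b c} → Triangle a b c → Triangle c (star b) a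
  Triangle-rotateʳ (x , y , z , xy , yz , xz) = x , z , y , xz , rel-flip yz , xy

  Triangle-reverse : ∀ {a b c} → Triangle a b c → Triangle (star b) (star a) (star c)
  Triangle-reverse (x , y , z , xy , yz , xz) = z , y , x , rel-flip yz , rel-flip xy , rel-flip xz

  Triangle-inverse : ∀ {a} → Triangle (star a) a one
  Triangle-inverse {a} with nonempty a
  ... | x , y , xy≡a = y , x , y , rel-flip xy≡a , xy≡a , from (one-diag y y) refl

  Triangle-unitʳ : ∀ {a} → Triangle a one a
  Triangle-unitʳ {a} with nonempty a
  ... | x , y , xy≡a = x , y , y , xy≡a , from (one-diag y y) refl , xy≡a

  ProdIsSingleton-triangle : ∀ {p q s} → ProdIsSingleton S p q s → Triangle p q s
  ProdIsSingleton-triangle pq≡s = to ∈·⇔Triangle (from (pq≡s _) refl)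

  ProdIsSingleton-unique : ∀ {p q r s} → ProdIsSingleton S p q s → Triangle p q r → r ≡ s
  ProdIsSingleton-unique pq≡s pqr = to (pq≡s _) (from ∈·⇔Triangle pqr)

  ProdCard1⇒ProdIsSingleton : ∀ {p q r} → ProdCard1 S p q → Triangle p q r →
                              ProdIsSingleton S p q r
  ProdCard1⇒ProdIsSingleton (s , pq≡s) pqr r' = mk⇔
    (λ r'∈pq → trans (to (pq≡s r') r'∈pq) (sym (ProdIsSingleton-unique pq≡s pqr)))
    (λ { refl → from ∈·⇔Triangle pqr })

  ProdIsSingleton-fromReverse : ∀ {p q s} → ProdIsSingleton S (star q) (star p) (star s) →
                                Triangle p q s → ProdIsSingleton S p q s
  ProdIsSingleton-fromReverse q*p*≡s* pqs r = mk⇔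
    (λ r∈pq → star-injective
       (ProdIsSingleton-unique q*p*≡s* (Triangle-reverse (to ∈·⇔Triangle r∈pq))))
    (λ { refl → from ∈·⇔Triangle pqs })

module Stabilisers (S : Scheme) {T : Fin (Scheme.m S) → Set} (T-closed : Closed S T) where
  open Scheme S
  open Triangles S

  closed-one : ∀ {p} → T p → T one
  closed-one Tp = T-closed _ _ one Tp Tp (from ∈·⇔Triangle Triangle-inverse)

  closed-star : ∀ {p} → T p → T (star p)
  closed-star Tp = T-closed _ _ _ Tp (closed-one Tp) (from ∈·⇔Triangle Triangle-unitʳ)

  LeftStabiliser RightStabiliser : Fin m → Fin m → Set
  LeftStabiliser  s t = T t × ProdIsSingleton S t s s
  RightStabiliser s t = T t × ProdIsSingleton S s t s

  LeftStabiliser-star : ∀ {s} → (∀ t → T t → ProdCard1 S t s) →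
                        ∀ {t} → LeftStabiliser s t → LeftStabiliser s (star t)
  LeftStabiliser-star card (Tt , ts≡s) =
    closed-star Tt ,
    ProdCard1⇒ProdIsSingleton (card _ (closed-star Tt))
      (Triangle-rotateˡ (ProdIsSingleton-triangle ts≡s))

  LeftStabiliser-closed : ∀ {s} → (∀ t → T t → ProdCard1 S t s) →
                          Closed S (LeftStabiliser s)
  LeftStabiliser-closed {s} card p q r p∈T'@(Tp , _) (Tq , qs≡s) r∈p*q =
    Tr , ProdCard1⇒ProdIsSingleton (card r Tr) rss
    where
      Tr : T r
      Tr = T-closed p q r Tp Tq r∈p*q

      p*s≡s : ProdIsSingleton S (star p) s s
      p*s≡s = proj₂ (LeftStabiliser-star card p∈T')

      rss : Triangle r s s
      rss with to ∈·⇔Triangle r∈p*q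
      ... | x , w , y , xw≡p* , wy≡q , xy≡r
        with Triangle-complete (Triangle-rotateʳ (ProdIsSingleton-triangle qs≡s)) w y wy≡q
      ... | v , wv≡s , vy≡s* =
        x , y , v , xy≡r , rel-flip-star vy≡s* ,
        ProdIsSingleton-unique p*s≡s (x , w , v , xw≡p* , wv≡s , refl)

  RightStabiliser-closed : ∀ {s} → (∀ t → T t → ProdCard1 S t (star s)) →
                           Closed S (RightStabiliser s)
  RightStabiliser-closed {s} card p q r (Tp , sp≡s) (Tq , sq≡s) r∈p*q =
    Tr , ProdIsSingleton-fromReverse
           (ProdCard1⇒ProdIsSingleton (card _ (closed-star Tr)) (Triangle-reverse srs)) srs
    where
      Tr : T r
      Tr = T-closed p q r Tp Tq r∈p*q

      srs : Triangle s r s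
      srs with to ∈·⇔Triangle r∈p*q
      ... | x , w , y , xw≡p* , wy≡q , xy≡r
        with Triangle-complete (Triangle-rotateˡ (ProdIsSingleton-triangle sp≡s))
                               w x (rel-flip-star xw≡p*)
      ... | v , wv≡s* , vx≡s =
        v , x , y , vx≡s , xy≡r ,
        ProdIsSingleton-unique sq≡s (v , w , y , rel-flip-star wv≡s* , wy≡q , refl)

module _ {U S : Scheme} (i : Morphism U S) where
  private
    module U = Scheme U
    module S = Scheme S
  open Morphism i

  Morphism-rl-star : ∀ u → rl (U.star u) ≡ S.star (rl u)
  Morphism-rl-star u with U.nonempty u
  ... | y , y' , yy'≡u = begin
    rl (U.star u)                   ≡⟨ cong (rl ∘ U.star) (sym yy'≡u) ⟩
    rl (U.star (U.rel y y'))        ≡⟨ cong rl (sym (U.star-rel y y')) ⟩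
    rl (U.rel y' y)                 ≡⟨ sym (pt-rel y' y) ⟩
    S.rel (pt y') (pt y)            ≡⟨ S.star-rel (pt y) (pt y') ⟩
    S.star (S.rel (pt y) (pt y'))   ≡⟨ cong S.star (trans (pt-rel y y') (cong rl yy'≡u)) ⟩
    S.star (rl u)                   ∎
    where open ≡-Reasoning

lemma7p4 : (U S : BasedScheme) (T : Fin (Scheme.m (BasedScheme.scheme S)) → Set)
    → Closed (BasedScheme.scheme S) T
    → (i : BasedMorphism U S)
    → IsIsoToQuotient (BasedMorphism.mor i) T
    → (∀ u t → T t → ProdCard1 (BasedScheme.scheme S) t (BasedMorphism.rl i u))
    → ∀ u
    → Closed (BasedScheme.scheme S) (λ t → T t × ProdIsSingleton (BasedScheme.scheme S) t (BasedMorphism.rl i u) (BasedMorphism.rl i u))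
    × Closed (BasedScheme.scheme S) (λ t → T t × ProdIsSingleton (BasedScheme.scheme S) (BasedMorphism.rl i u) t (BasedMorphism.rl i u))
lemma7p4 U S T T-closed i _ card u =
  LeftStabiliser-closed (λ t → card u t) ,
  RightStabiliser-closed (λ t Tt → subst (ProdCard1 (BasedScheme.scheme S) t)
                                         (Morphism-rl-star mor u) (card (U.star u) t Tt))
  where
    module U = BasedScheme U
    open BasedMorphism i using (mor)
    open Stabilisers (BasedScheme.scheme S) T-closed
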